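{- Let $n\ge 1$, let $n_0,n_1\ge 0$ with $n_0+n_1=n$, and let $C$ be a color map on the triangular lattice of size $n$ such that each of the three boundary sides carries exactly $n_0$ edges of color $0$ and $n_1$ edges of color $1$. Let $m(C)$ and $s(C)$ be the numbers of edges of $C$ of color $m$ and of color $3$ respectively. Then $$m(C)=G(C,0)+G(C,1)+G(C,2)-n_0n_1$$ and $$s(C)=2n_0n_1-G(C,0)-G(C,1)-G(C,2).$$
   Context: Let $\xi=e^{i\pi/3}$ and $T_n=\{r+s\xi:\ r,s\in\mathbb{Z}_{\ge0},\ r+s\le n\}\subset\mathbb{C}$. The edges of the lattice are the segments $[z,z+w]$ with $z,z+w\in T_n$ and $w\in\{1,\xi,\bar\xi\}$; the faces are the unit triangles with vertices in $T_n$. A color map is a map $C$ from the set of edges to $\{0,1,3,m\}$ such that, for every triangular face, the colors of its three edges read in clockwise order form, up to cyclic rotation, one of the triples $(0,0,0)$, $(1,1,1)$, $(1,0,3)$, $(0,1,m)$. Boundary sides: bottom edges $B_k=[k-1,k]$, right edges $R_k=[(k-1)+(n-k+1)\xi,\ k+(n-k)\xi]$, left edges $L_k=[(k-1)\xi,k\xi]$, for $1\le k\le n$. Gash numbers: $G(C,0)=\sum_{k:\,C(B_k)=0}\#\{k'>k: C(B_{k'})=1\}$ (number of $1$-colored bottom edges east of each $0$-colored bottom edge), $G(C,1)=\sum_{k:\,C(R_k)=0}\#\{k'<k: C(R_{k'})=1\}$ (number of $1$-colored right edges north of each $0$-colored right edge), $G(C,2)=\sum_{k:\,C(L_k)=0}\#\{k'<k: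 C(L_{k'})=1\}$ (number of $1$-colored left edges south of each $0$-colored left edge). -}

module Defs where

open import Data.Nat using (ℕ; zero; suc; _+_; _*_; _∸_; _<_)
open import Data.Bool using (Bool; true; false)
open import Data.List using (List; upTo; map)
open import Data.Nat.ListAction using (sum)
open import Data.Product using (_×_)
open import Data.Nat using (_<ᵇ_)

data Color : Set where
  c0 c1 c3 cm : Color

_=ᶜ_ : Color → Color → Bool
c0 =ᶜ c0 = true
c1 =ᶜ c1 = true
c3 =ᶜ c3 = true
cm =ᶜ cm = true
_ =ᶜ _ = false

-- Vertices of T_n : r + s ξ with r + s ≤ n, written as pairs (r , s).
-- Edges are indexed by a direction and a pair (r , s) with r + s < n:
--   hor r s : [ (r,s) , (r+1,s) ]        (direction 1)
--   up  r s : [ (r,s) , (r,s+1) ]        (direction ξ)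
--   dg  r s : [ (r,s+1) , (r+1,s) ]      (direction ξ̄ = 1 - ξ, from (r,s+1))
-- This is a bijection between {(dir , r , s) | r + s < n} and the edge set.
data Dir : Set where
  hor up dg : Dir

-- A color map on T_n: a coloring of the edges.  Values at (r , s) with
-- r + s ≥ n are irrelevant (not edges) and never inspected below.
ColoringData : Set
ColoringData = Dir → ℕ → ℕ → Color

-- Allowed clockwise triples, up to cyclic rotation.
data Allowed : Color → Color → Color → Set where
  a000 : Allowed c0 c0 c0
  a111 : Allowed c1 c1 c1
  a103 : Allowed c1 c0 c3
  a031 : Allowed c0 c3 c1
  a310 : Allowed c3 c1 c0
  a01m : Allowed c0 c1 cm
  a1m0 : Allowed c1 cm c0
  am01 : Allowed cm c0 c1

-- Upward triangle with vertices z=(r,s), z+1, z+ξ (r + s < n):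
-- clockwise edges: right (dg r s), bottom (hor r s), left (up r s).
-- Downward triangle with vertices z+ξ, z+1+ξ, z+1 (r + s + 2 ≤ n):
-- clockwise edges: top (hor r (s+1)), right (up (r+1) s), left (dg r s).
IsColorMap : ℕ → ColoringData → Set
IsColorMap n C =
  (∀ r s → r + s < n → Allowed (C dg r s) (C hor r s) (C up r s)) ×
  (∀ r s → suc (r + s) < n → Allowed (C hor r (suc s)) (C up (suc r) s) (C dg r s))

-- Boundary edges, indexed by i = k - 1 ∈ {0,…,n-1}:
--   B_k = [k-1, k]                          = hor (k-1) 0
--   R_k = [(k-1)+(n-k+1)ξ , k+(n-k)ξ]       = dg (k-1) (n-k)
--   L_k = [(k-1)ξ , kξ]                     = up 0 (k-1)
bottom right left : ℕ → ColoringData → ℕ → Color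
bottom n C i = C hor i 0
right  n C i = C dg i (n ∸ suc i)
left   n C i = C up 0 i

[_] : Bool → ℕ
[ true ] = 1
[ false ] = 0

Σ< : ℕ → (ℕ → ℕ) → ℕ
Σ< n f = sum (map f (upTo n))

countSide : ℕ → (ℕ → Color) → Color → ℕ
countSide n side c = Σ< n (λ i → [ side i =ᶜ c ])

gashAfter : ℕ → (ℕ → Color) → ℕ
gashAfter n side = Σ< n (λ k → [ side k =ᶜ c0 ] *
                     Σ< n (λ k' → [ k <ᵇ k' ] * [ side k' =ᶜ c1 ]))

gashBefore : ℕ → (ℕ → Color) → ℕ
gashBefore n side = Σ< n (λ k → [ side k =ᶜ c0 ] * Σ< k (λ k' → [ side k' =ᶜ c1 ]))

G0 G1 G2 : ℕ → ColoringData → ℕ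
G0 n C = gashAfter n (bottom n C)
G1 n C = gashBefore n (right n C)
G2 n C = gashBefore n (left n C)

countColor : ℕ → ColoringData → Color → ℕ
countColor n C c =
  Σ< n (λ r → Σ< (n ∸ r) (λ s →
     [ C hor r s =ᶜ c ] + [ C up r s =ᶜ c ] + [ C dg r s =ᶜ c ]))

mC sC : ℕ → ColoringData → ℕ
mC n C = countColor n C cm
sC n C = countColor n C c3

-- Let P₁ be the 1-deflation of C, the map from vertices to ℤ² that collapses the 0-edges,
-- keeps the 1-edges and sends 3- and m-edges to the vectors forced by the allowed faces;
-- the 0-deflation P₀ collapses the 1-edges instead.  For a bilinear form β on ℤ², the edge
-- function β (P₀ p) (P₁ q) − β (P₀ q) (P₁ p), corrected by weights on the 3- and m-edges,
-- has around every face a circulation determined by the colours of the face: 0 on down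
-- faces, and on up faces −2 (#3 + #m) for β = det and 2 (#3 − #m) for β twice the Euclidean
-- inner product.  By Green's theorem the sum over all faces is the circulation along the
-- boundary, where the deflations run along the sides and only the boundary words matter:
-- for det it is −2 n₀ n₁, and for the inner product it is twice the sum over the sides, read
-- in the direction of traversal, of #(0 before 1) − #(1 before 0).  The second count is the
-- gash number of the side and the two add up to n₀ n₁, so s + m = n₀ n₁ and
-- s − m = 3 n₀ n₁ − 2 (G₀ + G₁ + G₂).

module Submission where

open import Defs
open import Data.Nat.Base as ℕ using (ℕ; zero; suc; _∸_; _<_; _≤_; _<ᵇ_; z≤n; s≤s)
import Data.Nat.Properties as ℕ
open import Data.List.Properties using (map-applyUpTo)
open import Data.Nat.ListAction using (sum)
open import Data.Product.Base using (_×_; _,_; proj₁; proj₂)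
open import Function.Base using (id; _∘_)
open import Relation.Binary.PropositionalEquality
  using (_≡_; refl; sym; trans; cong; cong₂; subst; module ≡-Reasoning)

Σ<-suc : ∀ n f → Σ< (suc n) f ≡ f 0 ℕ.+ Σ< n (f ∘ suc)
Σ<-suc n f = cong (λ xs → f 0 ℕ.+ sum xs)
  (trans (map-applyUpTo suc f n) (sym (map-applyUpTo id (f ∘ suc) n)))

module MixedArea where

  open import Data.Integer.Base using (ℤ; +_; -_; _+_; _-_; _*_; 0ℤ; 1ℤ; -1ℤ)
  import Data.Integer.Properties as ℤ
  open import Data.Integer.Tactic.RingSolver using (solve-∀)

  -- Sums over initial segments of ℕ

  ∑ : ℕ → (ℕ → ℤ) → ℤ
  ∑ zero    f = 0ℤ
  ∑ (suc n) f = f 0 + ∑ n (f ∘ suc)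

  infix 7 ∑
  syntax ∑ n (λ i → e) = ∑[ i < n ] e

  ∑-cong : ∀ n {f g : ℕ → ℤ} → (∀ i → i < n → f i ≡ g i) → ∑ n f ≡ ∑ n g
  ∑-cong zero    f≗g = refl
  ∑-cong (suc n) f≗g =
    cong₂ _+_ (f≗g 0 (s≤s z≤n)) (∑-cong n (λ i i<n → f≗g (suc i) (s≤s i<n)))

  ∑-zero : ∀ n {f : ℕ → ℤ} → (∀ i → i < n → f i ≡ 0ℤ) → ∑ n f ≡ 0ℤ
  ∑-zero zero    f≗0 = refl
  ∑-zero (suc n) f≗0 =
    cong₂ _+_ (f≗0 0 (s≤s z≤n)) (∑-zero n (λ i i<n → f≗0 (suc i) (s≤s i<n)))

  ∑-distrib-+ : ∀ n (f g : ℕ → ℤ) → ∑[ i < n ] (f i + g i) ≡ ∑ n f + ∑ n g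
  ∑-distrib-+ zero    f g = refl
  ∑-distrib-+ (suc n) f g = trans
    (cong (_+_ (f 0 + g 0)) (∑-distrib-+ n (f ∘ suc) (g ∘ suc)))
    (interchange (f 0) (g 0) (∑ n (f ∘ suc)) (∑ n (g ∘ suc)))
    where
    interchange : ∀ a b c d → a + b + (c + d) ≡ a + c + (b + d)
    interchange = solve-∀

  ∑-distrib-minus : ∀ n (f g : ℕ → ℤ) → ∑[ i < n ] (f i - g i) ≡ ∑ n f - ∑ n g
  ∑-distrib-minus zero    f g = refl
  ∑-distrib-minus (suc n) f g = trans
    (cong (_+_ (f 0 - g 0)) (∑-distrib-minus n (f ∘ suc) (g ∘ suc)))
    (interchange (f 0) (g 0) (∑ n (f ∘ suc)) (∑ n (g ∘ suc)))
    where
    interchange : ∀ a b c d → a - b + (c - d) ≡ a + c - (b + d)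
    interchange = solve-∀

  *-distribʳ-∑ : ∀ n (f : ℕ → ℤ) c → ∑ n f * c ≡ ∑[ i < n ] (f i * c)
  *-distribʳ-∑ zero    f c = refl
  *-distribʳ-∑ (suc n) f c = trans
    (ℤ.*-distribʳ-+ c (f 0) (∑ n (f ∘ suc)))
    (cong (_+_ (f 0 * c)) (*-distribʳ-∑ n (f ∘ suc) c))

  ∑-last : ∀ n (f : ℕ → ℤ) → ∑ (suc n) f ≡ ∑ n f + f n
  ∑-last zero    f = ℤ.+-comm (f 0) 0ℤ
  ∑-last (suc n) f = trans
    (cong (_+_ (f 0)) (∑-last n (f ∘ suc)))
    (sym (ℤ.+-assoc (f 0) (∑ n (f ∘ suc)) (f (suc n))))

  pos-Σ< : ∀ n f → + Σ< n f ≡ ∑[ i < n ] + f i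
  pos-Σ< zero    f = refl
  pos-Σ< (suc n) f = trans
    (cong +_ (Σ<-suc n f))
    (trans (ℤ.pos-+ (f 0) (Σ< n (f ∘ suc))) (cong (_+_ (+ f 0)) (pos-Σ< n (f ∘ suc))))

  ∑-after : ∀ k n (f : ℕ → ℤ) → k < n → ∑[ j < n ] (+ [ k <ᵇ j ] * f j) ≡ ∑ n f - ∑ (suc k) f
  ∑-after zero    (suc n) f _ = trans
    (cong (_+_ 0ℤ) (∑-cong n (λ j _ → ℤ.*-identityˡ (f (suc j)))))
    (shift (f 0) (∑ n (f ∘ suc)))
    where
    shift : ∀ a b → 0ℤ + b ≡ a + b - (a + 0ℤ)
    shift = solve-∀
  ∑-after (suc k) (suc n) f (s≤s k<n) = trans
    (cong (_+_ 0ℤ) (∑-after k n (f ∘ suc) k<n))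
    (shift (f 0) (∑ n (f ∘ suc)) (∑ (suc k) (f ∘ suc)))
    where
    shift : ∀ a b c → 0ℤ + (b - c) ≡ a + b - (a + c)
    shift = solve-∀

  ∑-product-rule : ∀ (ξ η : ℕ → ℤ) n →
    ∑[ k < n ] (∑ k ξ * η k + ξ k * ∑ k η + ξ k * η k) ≡ ∑ n ξ * ∑ n η
  ∑-product-rule ξ η zero    = refl
  ∑-product-rule ξ η (suc n) = begin
    ∑ (suc n) F                    ≡⟨ ∑-last n F ⟩
    ∑ n F + F n                    ≡⟨ cong (_+ F n) (∑-product-rule ξ η n) ⟩
    ∑ n ξ * ∑ n η + F n            ≡⟨ expand (∑ n ξ) (∑ n η) (ξ n) (η n) ⟩
    (∑ n ξ + ξ n) * (∑ n η + η n)  ≡⟨ sym (cong₂ _*_ (∑-last n ξ) (∑-last n η)) ⟩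
    ∑ (suc n) ξ * ∑ (suc n) η      ∎
    where
    open ≡-Reasoning
    F : ℕ → ℤ
    F k = ∑ k ξ * η k + ξ k * ∑ k η + ξ k * η k
    expand : ∀ X Y x y → X * Y + (X * y + x * Y + x * y) ≡ (X + x) * (Y + y)
    expand = solve-∀

  crossSum : (ℕ → ℤ) → (ℕ → ℤ) → ℕ → ℤ
  crossSum ξ η m = ∑[ k < m ] (∑ k ξ * η k - ξ k * ∑ k η)

  -- Green's theorem on the triangle

  upCirc downCirc : (Dir → ℕ → ℕ → ℤ) → ℕ → ℕ → ℤ
  upCirc   ω r s = ω up r s + ω dg r s - ω hor r s
  downCirc ω r s = ω hor r (suc s) - ω up (suc r) s - ω dg r s

  faceSum : ℕ → (ℕ → ℕ → ℤ) → (ℕ → ℕ → ℤ) → ℤ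
  faceSum n U D = ∑[ r < n ] (∑[ s < n ∸ r ] U r s + ∑[ s < n ∸ suc r ] D r s)

  boundaryCirc : ℕ → (Dir → ℕ → ℕ → ℤ) → ℤ
  boundaryCirc n ω =
    ∑[ s < n ] ω up 0 s + ∑[ r < n ] ω dg r (n ∸ suc r) - ∑[ r < n ] ω hor r 0

  column-circulation : ∀ (ω : Dir → ℕ → ℕ → ℤ) r m →
    ∑[ s < suc m ] upCirc ω r s + ∑[ s < m ] downCirc ω r s
      ≡ ∑[ s < suc m ] ω up r s - ∑[ s < m ] ω up (suc r) s + (ω dg r m - ω hor r 0)
  column-circulation ω r zero = base (ω up r 0) (ω dg r 0) (ω hor r 0)
    where
    base : ∀ u d h → u + d - h + 0ℤ + 0ℤ ≡ u + 0ℤ - 0ℤ + (d - h)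
    base = solve-∀
  column-circulation ω r (suc m) = trans
    (rearrange (ω up r 0) (ω dg r 0) (ω hor r 0) (ω hor r 1) (ω up (suc r) 0) U D)
    (trans (cong (λ x → ω up r 0 - ω up (suc r) 0 - ω hor r 0 + ω hor r 1 + x)
                 (column-circulation (λ d r s → ω d r (suc s)) r m))
           (step (ω up r 0) (ω up (suc r) 0) (ω hor r 0) (ω hor r 1)
                 (∑[ s < suc m ] ω up r (suc s)) (∑[ s < m ] ω up (suc r) (suc s)) (ω dg r (suc m))))
    where
    U D : ℤ
    U = ∑[ s < suc m ] upCirc ω r (suc s)
    D = ∑[ s < m ] downCirc ω r (suc s)
    rearrange : ∀ u d h h₁ u′ U D → u + d - h + U + (h₁ - u′ - d + D)
                                  ≡ u - u′ - h + h₁ + (U + D)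
    rearrange = solve-∀
    step : ∀ u u′ h h₁ A B e → u - u′ - h + h₁ + (A - B + (e - h₁))
                             ≡ u + A - (u′ + B) + (e - h)
    step = solve-∀

  green : ∀ n ω → faceSum n (upCirc ω) (downCirc ω) ≡ boundaryCirc n ω
  green zero    ω = refl
  green (suc n) ω = trans
    (cong₂ _+_ (column-circulation ω 0 n) (green n (λ d r s → ω d (suc r) s)))
    (combine (∑[ s < suc n ] ω up 0 s) (∑[ s < n ] ω up 1 s) (ω dg 0 n) (ω hor 0 0)
             (∑[ r < n ] ω dg (suc r) (n ∸ suc r)) (∑[ r < n ] ω hor (suc r) 0))
    where
    combine : ∀ L₀ L₁ d h D H → L₀ - L₁ + (d - h) + (L₁ + D - H) ≡ L₀ + (d + D) - (h + H)
    combine = solve-∀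

  -- Bilinear forms and potentials on ℤ²

  V : Set
  V = ℤ × ℤ

  0v : V
  0v = 0ℤ , 0ℤ

  infixr 6 _⊕_
  infixr 7 _·_

  _⊕_ : V → V → V
  u ⊕ v = proj₁ u + proj₁ v , proj₂ u + proj₂ v

  _·_ : ℤ → V → V
  c · v = c * proj₁ v , c * proj₂ v

  ⊕-assoc : ∀ u v w → (u ⊕ v) ⊕ w ≡ u ⊕ v ⊕ w
  ⊕-assoc (u₁ , u₂) (v₁ , v₂) (w₁ , w₂) = cong₂ _,_ (ℤ.+-assoc u₁ v₁ w₁) (ℤ.+-assoc u₂ v₂ w₂)

  ·-identityˡ : ∀ v → 1ℤ · v ≡ v
  ·-identityˡ (v₁ , v₂) = cong₂ _,_ (ℤ.*-identityˡ v₁) (ℤ.*-identityˡ v₂)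

  ·-distribʳ-+-⊕ : ∀ a b w v → a · w ⊕ b · w ⊕ v ≡ (b + a) · w ⊕ v
  ·-distribʳ-+-⊕ a b (w₁ , w₂) (v₁ , v₂) = cong₂ _,_ (lemma a b w₁ v₁) (lemma a b w₂ v₂)
    where
    lemma : ∀ a b w x → a * w + (b * w + x) ≡ (b + a) * w + x
    lemma = solve-∀

  record IsBilinear (β : V → V → ℤ) : Set where
    field
      linearˡ : ∀ c u v w → β (c · u ⊕ v) w ≡ c * β u w + β v w
      linearʳ : ∀ c u v w → β u (c · v ⊕ w) ≡ c * β u v + β u w

    additiveˡ : ∀ u v w → β (u ⊕ v) w ≡ β u w + β v w
    additiveˡ u v w = trans (cong (λ u′ → β (u′ ⊕ v) w) (sym (·-identityˡ u)))
      (trans (linearˡ 1ℤ u v w) (cong (_+ β v w) (ℤ.*-identityˡ (β u w))))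

    additiveʳ : ∀ u v w → β u (v ⊕ w) ≡ β u v + β u w
    additiveʳ u v w = trans (cong (λ v′ → β u (v′ ⊕ w)) (sym (·-identityˡ v)))
      (trans (linearʳ 1ℤ u v w) (cong (_+ β u w) (ℤ.*-identityˡ (β u v))))

    private
      neg-cancel : ∀ a → -1ℤ * a + a ≡ 0ℤ
      neg-cancel = solve-∀

    zeroˡ : ∀ w → β 0v w ≡ 0ℤ
    zeroˡ w = trans (linearˡ -1ℤ 0v 0v w) (neg-cancel (β 0v w))

    zeroʳ : ∀ u → β u 0v ≡ 0ℤ
    zeroʳ u = trans (linearʳ -1ℤ u 0v 0v) (neg-cancel (β u 0v))

    scaledˡ : ∀ c u w → β (c · u ⊕ 0v) w ≡ c * β u w
    scaledˡ c u w = trans (linearˡ c u 0v w)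
      (trans (cong (_+_ (c * β u w)) (zeroˡ w)) (ℤ.+-identityʳ (c * β u w)))

    scaledʳ : ∀ c u w → β u (c · w ⊕ 0v) ≡ c * β u w
    scaledʳ c u w = trans (linearʳ c u w 0v)
      (trans (cong (_+_ (c * β u w)) (zeroʳ u)) (ℤ.+-identityʳ (c * β u w)))

  form : ℤ → ℤ → ℤ → ℤ → V → V → ℤ
  form a b c d (x₁ , x₂) (y₁ , y₂) = a * (x₁ * y₁) + b * (x₁ * y₂) + c * (x₂ * y₁) + d * (x₂ * y₂)

  form-isBilinear : ∀ a b c d → IsBilinear (form a b c d)
  form-isBilinear a b c d = record { linearˡ = linearˡ ; linearʳ = linearʳ }
    where
    linearˡ : ∀ k u v w → form a b c d (k · u ⊕ v) w ≡ k * form a b c d u w + form a b c d v w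
    linearˡ k (u₁ , u₂) (v₁ , v₂) (w₁ , w₂) = expand a b c d k u₁ u₂ v₁ v₂ w₁ w₂
      where
      expand : ∀ a b c d k u₁ u₂ v₁ v₂ w₁ w₂ →
        a * ((k * u₁ + v₁) * w₁) + b * ((k * u₁ + v₁) * w₂)
          + c * ((k * u₂ + v₂) * w₁) + d * ((k * u₂ + v₂) * w₂)
        ≡ k * (a * (u₁ * w₁) + b * (u₁ * w₂) + c * (u₂ * w₁) + d * (u₂ * w₂))
          + (a * (v₁ * w₁) + b * (v₁ * w₂) + c * (v₂ * w₁) + d * (v₂ * w₂))
      expand = solve-∀
    linearʳ : ∀ k u v w → form a b c d u (k · v ⊕ w) ≡ k * form a b c d u v + form a b c d u w
    linearʳ k (u₁ , u₂) (v₁ , v₂) (w₁ , w₂) = expand a b c d k u₁ u₂ v₁ v₂ w₁ w₂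
      where
      expand : ∀ a b c d k u₁ u₂ v₁ v₂ w₁ w₂ →
        a * (u₁ * (k * v₁ + w₁)) + b * (u₁ * (k * v₂ + w₂))
          + c * (u₂ * (k * v₁ + w₁)) + d * (u₂ * (k * v₂ + w₂))
        ≡ k * (a * (u₁ * v₁) + b * (u₁ * v₂) + c * (u₂ * v₁) + d * (u₂ * v₂))
          + (a * (u₁ * w₁) + b * (u₁ * w₂) + c * (u₂ * w₁) + d * (u₂ * w₂))
      expand = solve-∀

  Vertex : Set
  Vertex = ℕ × ℕ

  tail head : Dir → ℕ → ℕ → Vertex
  tail hor r s = r , s
  tail up  r s = r , s
  tail dg  r s = r , suc s
  head hor r s = suc r , s
  head up  r s = r , suc s
  head dg  r s = suc r , s

  IsPotential : ℕ → (Dir → ℕ → ℕ → V) → (Vertex → V) → Set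
  IsPotential n Δ x = ∀ d r s → r ℕ.+ s < n → x (head d r s) ≡ Δ d r s ⊕ x (tail d r s)

  IsClosed : ℕ → (Dir → ℕ → ℕ → V) → Set
  IsClosed n Δ =
    (∀ r s → r ℕ.+ s < n → Δ hor r s ≡ Δ dg r s ⊕ Δ up r s) ×
    (∀ r s → suc (r ℕ.+ s) < n → Δ hor r (suc s) ≡ Δ up (suc r) s ⊕ Δ dg r s)

  potential : (Dir → ℕ → ℕ → V) → Vertex → V
  potential Δ (zero  , zero)  = 0v
  potential Δ (zero  , suc s) = Δ up 0 s ⊕ potential Δ (0 , s)
  potential Δ (suc r , s)     = Δ hor r s ⊕ potential Δ (r , s)

  potential-isPotential : ∀ {n Δ} → IsClosed n Δ → IsPotential n Δ (potential Δ)
  potential-isPotential {n} {Δ} (closed-up , closed-down) = step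
    where
    open ≡-Reasoning
    x : Vertex → V
    x = potential Δ

    step-up : ∀ r s → r ℕ.+ s < n → x (r , suc s) ≡ Δ up r s ⊕ x (r , s)
    step-up zero    s _     = refl
    step-up (suc r) s r+s<n = begin
      Δ hor r (suc s) ⊕ x (r , suc s)
        ≡⟨ cong₂ _⊕_ (closed-down r s r+s<n) (step-up r s (ℕ.<⇒≤ r+s<n)) ⟩
      (Δ up (suc r) s ⊕ Δ dg r s) ⊕ Δ up r s ⊕ x (r , s)
        ≡⟨ ⊕-assoc (Δ up (suc r) s) (Δ dg r s) _ ⟩
      Δ up (suc r) s ⊕ Δ dg r s ⊕ Δ up r s ⊕ x (r , s)
        ≡⟨ cong (Δ up (suc r) s ⊕_) (sym (⊕-assoc (Δ dg r s) (Δ up r s) (x (r , s)))) ⟩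
      Δ up (suc r) s ⊕ (Δ dg r s ⊕ Δ up r s) ⊕ x (r , s)
        ≡⟨ cong (λ v → Δ up (suc r) s ⊕ v ⊕ x (r , s)) (sym (closed-up r s (ℕ.<⇒≤ r+s<n))) ⟩
      Δ up (suc r) s ⊕ Δ hor r s ⊕ x (r , s) ∎

    step : IsPotential n Δ x
    step hor r s _     = refl
    step up  r s r+s<n = step-up r s r+s<n
    step dg  r s r+s<n = begin
      Δ hor r s ⊕ x (r , s)              ≡⟨ cong (_⊕ x (r , s)) (closed-up r s r+s<n) ⟩
      (Δ dg r s ⊕ Δ up r s) ⊕ x (r , s)  ≡⟨ ⊕-assoc (Δ dg r s) (Δ up r s) (x (r , s)) ⟩
      Δ dg r s ⊕ Δ up r s ⊕ x (r , s)    ≡⟨ cong (Δ dg r s ⊕_) (sym (step-up r s r+s<n)) ⟩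
      Δ dg r s ⊕ x (r , suc s)           ∎

  segment-position : ∀ (x : ℕ → V) (ξ : ℕ → ℤ) w m →
    (∀ k → k < m → x (suc k) ≡ ξ k · w ⊕ x k) → ∀ k → k ≤ m → x k ≡ ∑ k ξ · w ⊕ x 0
  segment-position x ξ w m x-step zero    _   =
    sym (cong₂ _,_ (ℤ.+-identityˡ (proj₁ (x 0))) (ℤ.+-identityˡ (proj₂ (x 0))))
  segment-position x ξ w m x-step (suc k) k<m = begin
    x (suc k)                  ≡⟨ x-step k k<m ⟩
    ξ k · w ⊕ x k              ≡⟨ cong (ξ k · w ⊕_) (segment-position x ξ w m x-step k (ℕ.<⇒≤ k<m)) ⟩
    ξ k · w ⊕ ∑ k ξ · w ⊕ x 0  ≡⟨ ·-distribʳ-+-⊕ (ξ k) (∑ k ξ) w (x 0) ⟩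
    (∑ k ξ + ξ k) · w ⊕ x 0    ≡⟨ cong (λ c → c · w ⊕ x 0) (sym (∑-last k ξ)) ⟩
    ∑ (suc k) ξ · w ⊕ x 0      ∎
    where open ≡-Reasoning

  altForm : (V → V → ℤ) → (Vertex → V) → (Vertex → V) → Dir → ℕ → ℕ → ℤ
  altForm β x y d r s =
    β (x (tail d r s)) (y (head d r s)) - β (x (head d r s)) (y (tail d r s))

  module _ {β : V → V → ℤ} (isBilinear : IsBilinear β) where
    open IsBilinear isBilinear

    triangle-circulation : ∀ {x₁ x₂ x₃ y₁ y₂ y₃} u v u′ v′ →
      x₂ ≡ u ⊕ x₁ → x₃ ≡ u′ ⊕ x₁ → y₂ ≡ v ⊕ y₁ → y₃ ≡ v′ ⊕ y₁ →
      (β x₁ y₂ - β x₂ y₁) + (β x₂ y₃ - β x₃ y₂) - (β x₁ y₃ - β x₃ y₁) ≡ β u v′ - β u′ v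
    triangle-circulation {x₁} {y₁ = y₁} u v u′ v′ refl refl refl refl
      rewrite additiveˡ u x₁ (v′ ⊕ y₁) | additiveˡ u′ x₁ (v ⊕ y₁)
            | additiveˡ u x₁ y₁ | additiveˡ u′ x₁ y₁
            | additiveʳ x₁ v y₁ | additiveʳ x₁ v′ y₁ | additiveʳ u v′ y₁ | additiveʳ u′ v y₁
      = cancel (β x₁ v) (β x₁ v′) (β x₁ y₁) (β u v′) (β u y₁) (β u′ v) (β u′ y₁)
      where
      cancel : ∀ a a′ b c c′ e e′ →
        (a + b - (c′ + b)) + (c + c′ + (a′ + b) - (e + e′ + (a + b))) - (a′ + b - (e′ + b))
        ≡ c - e
      cancel = solve-∀

    altForm-upCirc : ∀ {n Δ Δ′ x y} → IsPotential n Δ x → IsPotential n Δ′ y →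
      ∀ r s → r ℕ.+ s < n →
      upCirc (altForm β x y) r s ≡ β (Δ up r s) (Δ′ hor r s) - β (Δ hor r s) (Δ′ up r s)
    altForm-upCirc {Δ = Δ} {Δ′} x-pot y-pot r s r+s<n = triangle-circulation
      (Δ up r s) (Δ′ up r s) (Δ hor r s) (Δ′ hor r s)
      (x-pot up r s r+s<n) (x-pot hor r s r+s<n) (y-pot up r s r+s<n) (y-pot hor r s r+s<n)

    altForm-downCirc : ∀ {n Δ Δ′ x y} → IsPotential n Δ x → IsPotential n Δ′ y →
      ∀ r s → suc (r ℕ.+ s) < n →
      downCirc (altForm β x y) r s
        ≡ β (Δ hor r (suc s)) (Δ′ dg r s) - β (Δ dg r s) (Δ′ hor r (suc s))
    altForm-downCirc {n} {Δ} {Δ′} {x} {y} x-pot y-pot r s r+1+s<n = trans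
      (flip (β (x q₁) (y q₂)) (β (x q₂) (y q₁)) (β (x q₃) (y q₂))
            (β (x q₂) (y q₃)) (β (x q₁) (y q₃)) (β (x q₃) (y q₁)))
      (triangle-circulation (Δ hor r (suc s)) (Δ′ hor r (suc s)) (Δ dg r s) (Δ′ dg r s)
        (x-pot hor r (suc s) r+[1+s]<n) (x-pot dg r s r+s<n)
        (y-pot hor r (suc s) r+[1+s]<n) (y-pot dg r s r+s<n))
      where
      r+s<n : r ℕ.+ s < n
      r+s<n = ℕ.<⇒≤ r+1+s<n
      r+[1+s]<n : r ℕ.+ suc s < n
      r+[1+s]<n = subst (_< n) (sym (ℕ.+-suc r s)) r+1+s<n
      q₁ q₂ q₃ : Vertex
      q₁ = r , suc s
      q₂ = suc r , suc s
      q₃ = suc r , s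
      flip : ∀ a b c d e f → a - b - (c - d) - (e - f) ≡ a - b + (d - c) - (e - f)
      flip = solve-∀

    alt-step : ∀ ξ η w x y → β x (η · w ⊕ y) - β (ξ · w ⊕ x) y ≡ η * β x w - ξ * β w y
    alt-step ξ η w x y rewrite linearʳ η x w y | linearˡ ξ w x y =
      cancel (η * β x w) (ξ * β w y) (β x y)
      where
      cancel : ∀ a b c → a + c - (b + c) ≡ a - b
      cancel = solve-∀

    module _ (x y : ℕ → V) (ξ η : ℕ → ℤ) (w : V) (m : ℕ)
             (x-step : ∀ k → k < m → x (suc k) ≡ ξ k · w ⊕ x k)
             (y-step : ∀ k → k < m → y (suc k) ≡ η k · w ⊕ y k) where

      segment-edge : ∀ k → k < m →
        β (x k) (y (suc k)) - β (x (suc k)) (y k)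
          ≡ η k * β (x 0) w - ξ k * β w (y 0) + (∑ k ξ * η k - ξ k * ∑ k η) * β w w
      segment-edge k k<m = begin
        β (x k) (y (suc k)) - β (x (suc k)) (y k)
          ≡⟨ cong₂ (λ p q → β (x k) p - β q (y k)) (y-step k k<m) (x-step k k<m) ⟩
        β (x k) (η k · w ⊕ y k) - β (ξ k · w ⊕ x k) (y k)
          ≡⟨ alt-step (ξ k) (η k) w (x k) (y k) ⟩
        η k * β (x k) w - ξ k * β w (y k)
          ≡⟨ cong₂ (λ p q → η k * β p w - ξ k * β w q)
                   (segment-position x ξ w m x-step k (ℕ.<⇒≤ k<m))
                   (segment-position y η w m y-step k (ℕ.<⇒≤ k<m)) ⟩
        η k * β (∑ k ξ · w ⊕ x 0) w - ξ k * β w (∑ k η · w ⊕ y 0)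
          ≡⟨ cong₂ (λ p q → η k * p - ξ k * q)
                   (linearˡ (∑ k ξ) w (x 0) w) (linearʳ (∑ k η) w w (y 0)) ⟩
        η k * (∑ k ξ * β w w + β (x 0) w) - ξ k * (∑ k η * β w w + β w (y 0))
          ≡⟨ regroup (η k) (ξ k) (∑ k ξ) (∑ k η) (β (x 0) w) (β w (y 0)) (β w w) ⟩
        η k * β (x 0) w - ξ k * β w (y 0) + (∑ k ξ * η k - ξ k * ∑ k η) * β w w ∎
        where
        open ≡-Reasoning
        regroup : ∀ η ξ X Y a b c →
          η * (X * c + a) - ξ * (Y * c + b) ≡ η * a - ξ * b + (X * η - ξ * Y) * c
        regroup = solve-∀

      altForm-segment : ∑[ k < m ] (β (x k) (y (suc k)) - β (x (suc k)) (y k))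
        ≡ ∑ m η * β (x 0) w - ∑ m ξ * β w (y 0) + crossSum ξ η m * β w w
      altForm-segment = begin
        ∑[ k < m ] (β (x k) (y (suc k)) - β (x (suc k)) (y k))
          ≡⟨ ∑-cong m segment-edge ⟩
        ∑[ k < m ] (η k * a - ξ k * b + cross k * c)
          ≡⟨ ∑-distrib-+ m (λ k → η k * a - ξ k * b) (λ k → cross k * c) ⟩
        ∑[ k < m ] (η k * a - ξ k * b) + ∑[ k < m ] (cross k * c)
          ≡⟨ cong₂ _+_ (∑-distrib-minus m (λ k → η k * a) (λ k → ξ k * b))
                       (sym (*-distribʳ-∑ m cross c)) ⟩
        ∑[ k < m ] (η k * a) - ∑[ k < m ] (ξ k * b) + crossSum ξ η m * c
          ≡⟨ cong₂ (λ p q → p - q + crossSum ξ η m * c)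
                   (sym (*-distribʳ-∑ m η a)) (sym (*-distribʳ-∑ m ξ b)) ⟩
        ∑ m η * a - ∑ m ξ * b + crossSum ξ η m * c ∎
        where
        open ≡-Reasoning
        a b c : ℤ
        a = β (x 0) w
        b = β w (y 0)
        c = β w w
        cross : ℕ → ℤ
        cross k = ∑ k ξ * η k - ξ k * ∑ k η

      altForm-segment-origin : x 0 ≡ 0v → y 0 ≡ 0v →
        ∑[ k < m ] (β (x k) (y (suc k)) - β (x (suc k)) (y k)) ≡ crossSum ξ η m * β w w
      altForm-segment-origin x₀ y₀ = begin
        ∑[ k < m ] (β (x k) (y (suc k)) - β (x (suc k)) (y k))
          ≡⟨ altForm-segment ⟩
        ∑ m η * β (x 0) w - ∑ m ξ * β w (y 0) + crossSum ξ η m * β w w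
          ≡⟨ cong₂ (λ p q → ∑ m η * p - ∑ m ξ * q + crossSum ξ η m * β w w)
                   (trans (cong (λ v → β v w) x₀) (zeroˡ w)) (trans (cong (β w) y₀) (zeroʳ w)) ⟩
        ∑ m η * 0ℤ - ∑ m ξ * 0ℤ + crossSum ξ η m * β w w
          ≡⟨ vanish (∑ m η) (∑ m ξ) (crossSum ξ η m * β w w) ⟩
        crossSum ξ η m * β w w ∎
        where
        open ≡-Reasoning
        vanish : ∀ a b c → a * 0ℤ - b * 0ℤ + c ≡ c
        vanish = solve-∀

  -- Deflations of a colour map

  edgeVector : Dir → V
  edgeVector hor = 1ℤ , 0ℤ
  edgeVector up  = 0ℤ , 1ℤ
  edgeVector dg  = 1ℤ , -1ℤ

  -- The displacement of an edge under the 1-deflation; (r , s) stands for r + s ξ.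
  δ₁ : Dir → Color → V
  δ₁ d   c0 = 0v
  δ₁ d   c1 = edgeVector d
  δ₁ hor c3 = 0ℤ , 1ℤ
  δ₁ up  c3 = -1ℤ , 1ℤ
  δ₁ dg  c3 = 1ℤ , 0ℤ
  δ₁ hor cm = 1ℤ , -1ℤ
  δ₁ up  cm = 1ℤ , 0ℤ
  δ₁ dg  cm = 0ℤ , -1ℤ

  swap : Color → Color
  swap c0 = c1
  swap c1 = c0
  swap c3 = cm
  swap cm = c3

  δ₀ : Dir → Color → V
  δ₀ d c = δ₁ d (swap c)

  Allowed-swap : ∀ {a b c} → Allowed a b c → Allowed (swap a) (swap b) (swap c)
  Allowed-swap a000 = a111
  Allowed-swap a111 = a000
  Allowed-swap a103 = a01m
  Allowed-swap a031 = a1m0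
  Allowed-swap a310 = am01
  Allowed-swap a01m = a103
  Allowed-swap a1m0 = a031
  Allowed-swap am01 = a310

  δ₁-closed-up : ∀ {a b c} → Allowed a b c → δ₁ hor b ≡ δ₁ dg a ⊕ δ₁ up c
  δ₁-closed-up a000 = refl
  δ₁-closed-up a111 = refl
  δ₁-closed-up a103 = refl
  δ₁-closed-up a031 = refl
  δ₁-closed-up a310 = refl
  δ₁-closed-up a01m = refl
  δ₁-closed-up a1m0 = refl
  δ₁-closed-up am01 = refl

  δ₁-closed-down : ∀ {a b c} → Allowed a b c → δ₁ hor a ≡ δ₁ up b ⊕ δ₁ dg c
  δ₁-closed-down a000 = refl
  δ₁-closed-down a111 = refl
  δ₁-closed-down a103 = refl
  δ₁-closed-down a031 = refl
  δ₁-closed-down a310 = refl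
  δ₁-closed-down a01m = refl
  δ₁-closed-down a1m0 = refl
  δ₁-closed-down am01 = refl

  data Binary : Color → Set where
    binary₀ : Binary c0
    binary₁ : Binary c1

  χ₀ χ₁ : Color → ℤ
  χ₀ c = + [ c =ᶜ c0 ]
  χ₁ c = + [ c =ᶜ c1 ]

  χ₀*χ₁≡0 : ∀ c → χ₀ c * χ₁ c ≡ 0ℤ
  χ₀*χ₁≡0 c0 = refl
  χ₀*χ₁≡0 c1 = refl
  χ₀*χ₁≡0 c3 = refl
  χ₀*χ₁≡0 cm = refl

  δ₁-binary : ∀ {c} → Binary c → ∀ d → δ₁ d c ≡ χ₁ c · edgeVector d
  δ₁-binary binary₀ d   = refl
  δ₁-binary binary₁ hor = refl
  δ₁-binary binary₁ up  = refl
  δ₁-binary binary₁ dg  = refl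

  δ₀-binary : ∀ {c} → Binary c → ∀ d → δ₀ d c ≡ χ₀ c · edgeVector d
  δ₀-binary binary₀ hor = refl
  δ₀-binary binary₀ up  = refl
  δ₀-binary binary₀ dg  = refl
  δ₀-binary binary₁ d   = refl

  -- Pair counts of a boundary word

  module _ (w : ℕ → Color) where
    private
      ξ η : ℕ → ℤ
      ξ = χ₀ ∘ w
      η = χ₁ ∘ w

    pos-gashBefore : ∀ n → + gashBefore n w ≡ ∑[ k < n ] (ξ k * ∑ k η)
    pos-gashBefore n = trans (pos-Σ< n _) (∑-cong n (λ k _ →
      trans (ℤ.pos-* [ w k =ᶜ c0 ] _) (cong (ξ k *_) (pos-Σ< k _))))

    pos-gashAfter : ∀ n → + gashAfter n w ≡ ∑[ k < n ] (ξ k * (∑ n η - ∑ (suc k) η))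
    pos-gashAfter n = trans (pos-Σ< n _) (∑-cong n (λ k k<n →
      trans (ℤ.pos-* [ w k =ᶜ c0 ] _) (cong (ξ k *_) (begin
        + Σ< n (λ j → [ k <ᵇ j ] ℕ.* [ w j =ᶜ c1 ])
          ≡⟨ pos-Σ< n _ ⟩
        ∑[ j < n ] + ([ k <ᵇ j ] ℕ.* [ w j =ᶜ c1 ])
          ≡⟨ ∑-cong n (λ j _ → ℤ.pos-* [ k <ᵇ j ] [ w j =ᶜ c1 ]) ⟩
        ∑[ j < n ] (+ [ k <ᵇ j ] * η j)
          ≡⟨ ∑-after k n η k<n ⟩
        ∑ n η - ∑ (suc k) η ∎))))
      where open ≡-Reasoning

    zeros-before-ones : ∀ n → ∑[ k < n ] (∑ k ξ * η k) ≡ + gashAfter n w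
    zeros-before-ones n = begin
      ∑[ k < n ] (∑ k ξ * η k)
        ≡⟨ ∑-cong n (λ k _ → split (∑ k ξ) (η k) (ξ k) (∑ k η)) ⟩
      ∑[ k < n ] (A k - B k)
        ≡⟨ ∑-distrib-minus n A B ⟩
      ∑ n A - ∑ n B
        ≡⟨ cong (_- ∑ n B) (trans (∑-product-rule ξ η n) (*-distribʳ-∑ n ξ (∑ n η))) ⟩
      ∑[ k < n ] (ξ k * ∑ n η) - ∑ n B
        ≡⟨ sym (∑-distrib-minus n (λ k → ξ k * ∑ n η) B) ⟩
      ∑[ k < n ] (ξ k * ∑ n η - B k)
        ≡⟨ ∑-cong n (λ k _ → trans (factor (ξ k) (∑ n η) (∑ k η) (η k))
                                   (cong (λ y → ξ k * (∑ n η - y)) (sym (∑-last k η)))) ⟩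
      ∑[ k < n ] (ξ k * (∑ n η - ∑ (suc k) η))
        ≡⟨ sym (pos-gashAfter n) ⟩
      + gashAfter n w ∎
      where
      open ≡-Reasoning
      A B : ℕ → ℤ
      A k = ∑ k ξ * η k + ξ k * ∑ k η + ξ k * η k
      B k = ξ k * ∑ k η + ξ k * η k
      split : ∀ X y x Y → X * y ≡ X * y + x * Y + x * y - (x * Y + x * y)
      split = solve-∀
      factor : ∀ x N Y y → x * N - (x * Y + x * y) ≡ x * (N - (Y + y))
      factor = solve-∀

    crossSum≡gashAfter-gashBefore : ∀ n → crossSum ξ η n ≡ + gashAfter n w - + gashBefore n w
    crossSum≡gashAfter-gashBefore n = trans
      (∑-distrib-minus n (λ k → ∑ k ξ * η k) (λ k → ξ k * ∑ k η))
      (cong₂ _-_ (zeros-before-ones n) (sym (pos-gashBefore n)))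

    gashAfter+gashBefore : ∀ n → + gashAfter n w + + gashBefore n w ≡ ∑ n ξ * ∑ n η
    gashAfter+gashBefore n = begin
      + gashAfter n w + + gashBefore n w
        ≡⟨ cong₂ _+_ (sym (zeros-before-ones n)) (pos-gashBefore n) ⟩
      ∑[ k < n ] (∑ k ξ * η k) + ∑[ k < n ] (ξ k * ∑ k η)
        ≡⟨ sym (∑-distrib-+ n (λ k → ∑ k ξ * η k) (λ k → ξ k * ∑ k η)) ⟩
      ∑[ k < n ] (∑ k ξ * η k + ξ k * ∑ k η)
        ≡⟨ ∑-cong n (λ k _ → sym (trans (cong (_+_ (∑ k ξ * η k + ξ k * ∑ k η)) (χ₀*χ₁≡0 (w k)))
                                          (ℤ.+-identityʳ _))) ⟩
      ∑[ k < n ] (∑ k ξ * η k + ξ k * ∑ k η + ξ k * η k)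
        ≡⟨ ∑-product-rule ξ η n ⟩
      ∑ n ξ * ∑ n η ∎
      where open ≡-Reasoning

  -- The two mixed-area identities

  -- twiceInner is twice the Euclidean inner product of the plane in the basis (1, ξ).
  det twiceInner : V → V → ℤ
  det        = form 0ℤ 1ℤ -1ℤ 0ℤ
  twiceInner = form (+ 2) 1ℤ 1ℤ (+ 2)

  -- Weights on the 3- and m-edges, the diagonals of the rhombi, chosen so that the
  -- circulation around every down face vanishes.
  detCorrection innerCorrection : Color → ℤ
  detCorrection c3 = 1ℤ
  detCorrection cm = 1ℤ
  detCorrection _  = 0ℤ
  innerCorrection c3 = -1ℤ
  innerCorrection cm = 1ℤ
  innerCorrection _  = 0ℤ

  oriented : Dir → ℤ → ℤ
  oriented hor x = x
  oriented up  x = - x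
  oriented dg  x = - x

  oriented-zero : ∀ d → oriented d 0ℤ ≡ 0ℤ
  oriented-zero hor = refl
  oriented-zero up  = refl
  oriented-zero dg  = refl

  oriented-binary : ∀ {ρ : Color → ℤ} → ρ c0 ≡ 0ℤ → ρ c1 ≡ 0ℤ →
    ∀ {c} → Binary c → ∀ d → oriented d (ρ c) ≡ 0ℤ
  oriented-binary ρ₀ ρ₁ binary₀ d = trans (cong (oriented d) ρ₀) (oriented-zero d)
  oriented-binary ρ₀ ρ₁ binary₁ d = trans (cong (oriented d) ρ₁) (oriented-zero d)

  -- a, b, c are the colours of the face in the clockwise order used by Allowed.
  upFaceCirc downFaceCirc : (V → V → ℤ) → (Color → ℤ) → Color → Color → Color → ℤ
  upFaceCirc   β ρ a b c = β (δ₀ up c) (δ₁ hor b) - β (δ₀ hor b) (δ₁ up c) + (- ρ c + - ρ a - ρ b)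
  downFaceCirc β ρ a b c = β (δ₀ hor a) (δ₁ dg c) - β (δ₀ dg c) (δ₁ hor a) + (ρ a - - ρ b - - ρ c)

  edgeCount : Color → Color → Color → Color → ℕ
  edgeCount k a b c = [ b =ᶜ k ] ℕ.+ [ c =ᶜ k ] ℕ.+ [ a =ᶜ k ]

  det-faces : ∀ {a b c} → Allowed a b c →
    upFaceCirc det detCorrection a b c ≡ (+ edgeCount c3 a b c + + edgeCount cm a b c) * - + 2
    × downFaceCirc det detCorrection a b c ≡ 0ℤ
  det-faces a000 = refl , refl
  det-faces a111 = refl , refl
  det-faces a103 = refl , refl
  det-faces a031 = refl , refl
  det-faces a310 = refl , refl
  det-faces a01m = refl , refl
  det-faces a1m0 = refl , refl
  det-faces am01 = refl , refl

  twiceInner-faces : ∀ {a b c} → Allowed a b c →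
    upFaceCirc twiceInner innerCorrection a b c ≡ (+ edgeCount c3 a b c - + edgeCount cm a b c) * + 2
    × downFaceCirc twiceInner innerCorrection a b c ≡ 0ℤ
  twiceInner-faces a000 = refl , refl
  twiceInner-faces a111 = refl , refl
  twiceInner-faces a103 = refl , refl
  twiceInner-faces a031 = refl , refl
  twiceInner-faces a310 = refl , refl
  twiceInner-faces a01m = refl , refl
  twiceInner-faces a1m0 = refl , refl
  twiceInner-faces am01 = refl , refl

  ∑△ : ℕ → (ℕ → ℕ → ℤ) → ℤ
  ∑△ n F = ∑[ r < n ] ∑[ s < n ∸ r ] F r s

  ∑△-distrib-+ : ∀ n (F G : ℕ → ℕ → ℤ) → ∑△ n (λ r s → F r s + G r s) ≡ ∑△ n F + ∑△ n G
  ∑△-distrib-+ n F G = trans (∑-cong n (λ r _ → ∑-distrib-+ (n ∸ r) (F r) (G r)))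
                             (∑-distrib-+ n (λ r → ∑ (n ∸ r) (F r)) (λ r → ∑ (n ∸ r) (G r)))

  ∑△-distrib-minus : ∀ n (F G : ℕ → ℕ → ℤ) → ∑△ n (λ r s → F r s - G r s) ≡ ∑△ n F - ∑△ n G
  ∑△-distrib-minus n F G = trans (∑-cong n (λ r _ → ∑-distrib-minus (n ∸ r) (F r) (G r)))
                             (∑-distrib-minus n (λ r → ∑ (n ∸ r) (F r)) (λ r → ∑ (n ∸ r) (G r)))

  *-distribʳ-∑△ : ∀ n (F : ℕ → ℕ → ℤ) c → ∑△ n F * c ≡ ∑△ n (λ r s → F r s * c)
  *-distribʳ-∑△ n F c = trans (*-distribʳ-∑ n (λ r → ∑ (n ∸ r) (F r)) c)
                              (∑-cong n (λ r _ → *-distribʳ-∑ (n ∸ r) (F r) c))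

  <∸⇒+< : ∀ n r s → s < n ∸ r → r ℕ.+ s < n
  <∸⇒+< zero    zero    s ()
  <∸⇒+< zero    (suc r) s ()
  <∸⇒+< (suc n) zero    s s<n   = s<n
  <∸⇒+< (suc n) (suc r) s s<n∸r = s≤s (<∸⇒+< n r s s<n∸r)

  ∸-suc : ∀ {n k} → k < n → n ∸ k ≡ suc (n ∸ suc k)
  ∸-suc k<n = ℕ.+-∸-assoc 1 k<n

  +∸-suc< : ∀ {n k} → k < n → k ℕ.+ (n ∸ suc k) < n
  +∸-suc< k<n = ℕ.≤-reflexive (ℕ.m+[n∸m]≡n k<n)

  solve-rhombus-counts : ∀ s m a g₀ g₁ g₂ h₀ h₁ h₂ →
    s + m ≡ a → s - m ≡ h₂ - g₂ + (h₁ - g₁) - (g₀ - h₀) →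
    g₀ + h₀ ≡ a → h₁ + g₁ ≡ a → h₂ + g₂ ≡ a →
    (m + a ≡ g₀ + g₁ + g₂) × (s + (g₀ + g₁ + g₂) ≡ + 2 * a)
  solve-rhombus-counts s m a g₀ g₁ g₂ h₀ h₁ h₂ sum diff pair₀ pair₁ pair₂ = m+a≡g , s+g≡2a
    where
    open ≡-Reasoning
    m+a≡g : m + a ≡ g₀ + g₁ + g₂
    m+a≡g = ℤ.*-cancelˡ-≡ (+ 2) (m + a) (g₀ + g₁ + g₂) (begin
      + 2 * (m + a)
        ≡⟨ step₁ s m a ⟩
      (s + m) - (s - m) + + 2 * a
        ≡⟨ cong₂ (λ p d → p - d + + 2 * a) sum diff ⟩
      a - (h₂ - g₂ + (h₁ - g₁) - (g₀ - h₀)) + + 2 * a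
        ≡⟨ step₂ a g₀ g₁ g₂ h₀ h₁ h₂ ⟩
      a - (g₀ + h₀) + (a - (h₁ + g₁)) + (a - (h₂ + g₂)) + + 2 * (g₀ + g₁ + g₂)
        ≡⟨ cong₂ (λ p q → p + q + + 2 * (g₀ + g₁ + g₂))
                 (cong₂ (λ p q → a - p + (a - q)) pair₀ pair₁) (cong (_-_ a) pair₂) ⟩
      a - a + (a - a) + (a - a) + + 2 * (g₀ + g₁ + g₂)
        ≡⟨ step₃ a (g₀ + g₁ + g₂) ⟩
      + 2 * (g₀ + g₁ + g₂) ∎)
      where
      step₁ : ∀ s m a → + 2 * (m + a) ≡ (s + m) - (s - m) + + 2 * a
      step₁ = solve-∀
      step₂ : ∀ a g₀ g₁ g₂ h₀ h₁ h₂ →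
        a - (h₂ - g₂ + (h₁ - g₁) - (g₀ - h₀)) + + 2 * a
        ≡ a - (g₀ + h₀) + (a - (h₁ + g₁)) + (a - (h₂ + g₂)) + + 2 * (g₀ + g₁ + g₂)
      step₂ = solve-∀
      step₃ : ∀ a g → a - a + (a - a) + (a - a) + + 2 * g ≡ + 2 * g
      step₃ = solve-∀
    s+g≡2a : s + (g₀ + g₁ + g₂) ≡ + 2 * a
    s+g≡2a = begin
      s + (g₀ + g₁ + g₂) ≡⟨ cong (_+_ s) (sym m+a≡g) ⟩
      s + (m + a)        ≡⟨ sym (ℤ.+-assoc s m a) ⟩
      s + m + a          ≡⟨ cong (_+ a) sum ⟩
      a + a              ≡⟨ double a ⟩
      + 2 * a            ∎
      where
      double : ∀ a → a + a ≡ + 2 * a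
      double = solve-∀

  module ColorMap (n : ℕ) (C : ColoringData) (isC : IsColorMap n C) where

    Δ₀ Δ₁ : Dir → ℕ → ℕ → V
    Δ₀ d r s = δ₀ d (C d r s)
    Δ₁ d r s = δ₁ d (C d r s)

    P₀ P₁ : Vertex → V
    P₀ = potential Δ₀
    P₁ = potential Δ₁

    P₀-isPotential : IsPotential n Δ₀ P₀
    P₀-isPotential = potential-isPotential
      ( (λ r s r+s<n → δ₁-closed-up (Allowed-swap (proj₁ isC r s r+s<n)))
      , (λ r s r+s<n → δ₁-closed-down (Allowed-swap (proj₂ isC r s r+s<n))))

    P₁-isPotential : IsPotential n Δ₁ P₁
    P₁-isPotential = potential-isPotential
      ( (λ r s r+s<n → δ₁-closed-up (proj₁ isC r s r+s<n))
      , (λ r s r+s<n → δ₁-closed-down (proj₂ isC r s r+s<n)))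

    correctedForm : (V → V → ℤ) → (Color → ℤ) → Dir → ℕ → ℕ → ℤ
    correctedForm β ρ d r s = altForm β P₀ P₁ d r s + oriented d (ρ (C d r s))

    pos-countColor : ∀ k →
      + countColor n C k ≡ ∑△ n (λ r s → + edgeCount k (C dg r s) (C hor r s) (C up r s))
    pos-countColor k = trans (pos-Σ< n _) (∑-cong n (λ r _ → pos-Σ< (n ∸ r) _))

    module _ {β : V → V → ℤ} (isBilinear : IsBilinear β) (ρ : Color → ℤ) where

      upCirc-correctedForm : ∀ r s → r ℕ.+ s < n →
        upCirc (correctedForm β ρ) r s ≡ upFaceCirc β ρ (C dg r s) (C hor r s) (C up r s)
      upCirc-correctedForm r s r+s<n = trans
        (split (altForm β P₀ P₁ up r s) (altForm β P₀ P₁ dg r s) (altForm β P₀ P₁ hor r s)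
               (- ρ (C up r s)) (- ρ (C dg r s)) (ρ (C hor r s)))
        (cong (_+ (- ρ (C up r s) + - ρ (C dg r s) - ρ (C hor r s)))
              (altForm-upCirc isBilinear {Δ = Δ₀} {Δ₁} {P₀} {P₁} P₀-isPotential P₁-isPotential
                              r s r+s<n))
        where
        split : ∀ a b c x y z → a + x + (b + y) - (c + z) ≡ a + b - c + (x + y - z)
        split = solve-∀

      downCirc-correctedForm : ∀ r s → suc (r ℕ.+ s) < n →
        downCirc (correctedForm β ρ) r s
          ≡ downFaceCirc β ρ (C hor r (suc s)) (C up (suc r) s) (C dg r s)
      downCirc-correctedForm r s r+1+s<n = trans
        (split (altForm β P₀ P₁ hor r (suc s)) (altForm β P₀ P₁ up (suc r) s)
               (altForm β P₀ P₁ dg r s)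
               (ρ (C hor r (suc s))) (- ρ (C up (suc r) s)) (- ρ (C dg r s)))
        (cong (_+ (ρ (C hor r (suc s)) - - ρ (C up (suc r) s) - - ρ (C dg r s)))
              (altForm-downCirc isBilinear {Δ = Δ₀} {Δ₁} {P₀} {P₁} P₀-isPotential P₁-isPotential
                                r s r+1+s<n))
        where
        split : ∀ a b c x y z → a + x - (b + y) - (c + z) ≡ a - b - c + (x - y - z)
        split = solve-∀

      faces≡boundary : (value : Color → Color → Color → ℤ) →
        (∀ {a b c} → Allowed a b c →
           upFaceCirc β ρ a b c ≡ value a b c × downFaceCirc β ρ a b c ≡ 0ℤ) →
        ∑△ n (λ r s → value (C dg r s) (C hor r s) (C up r s)) ≡ boundaryCirc n (correctedForm β ρ)
      faces≡boundary value face-values = trans (sym faces) (green n (correctedForm β ρ))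
        where
        faces : faceSum n (upCirc (correctedForm β ρ)) (downCirc (correctedForm β ρ))
              ≡ ∑△ n (λ r s → value (C dg r s) (C hor r s) (C up r s))
        faces = ∑-cong n (λ r _ → trans
          (cong₂ _+_
            (∑-cong (n ∸ r) (λ s s<n∸r → let r+s<n = <∸⇒+< n r s s<n∸r in
              trans (upCirc-correctedForm r s r+s<n) (proj₁ (face-values (proj₁ isC r s r+s<n)))))
            (∑-zero (n ∸ suc r) (λ s s<n∸r → let r+1+s<n = <∸⇒+< n (suc r) s s<n∸r in
              trans (downCirc-correctedForm r s r+1+s<n)
                    (proj₂ (face-values (proj₂ isC r s r+1+s<n))))))
          (ℤ.+-identityʳ _))

    module Boundary (left-binary   : ∀ k → k < n → Binary (left n C k))
                    (bottom-binary : ∀ k → k < n → Binary (bottom n C k))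
                    (right-binary  : ∀ k → k < n → Binary (right n C k)) where

      module SideSteps {δ : Dir → Color → V} {χ : Color → ℤ}
        (δ-binary : ∀ {c} → Binary c → ∀ d → δ d c ≡ χ c · edgeVector d)
        (x-isPotential : IsPotential n (λ d r s → δ d (C d r s)) (potential (λ d r s → δ d (C d r s))))
        where

        x : Vertex → V
        x = potential (λ d r s → δ d (C d r s))

        left-step : ∀ k → k < n → x (0 , suc k) ≡ χ (left n C k) · edgeVector up ⊕ x (0 , k)
        left-step k k<n = cong (_⊕ x (0 , k)) (δ-binary (left-binary k k<n) up)

        bottom-step : ∀ k → k < n → x (suc k , 0) ≡ χ (bottom n C k) · edgeVector hor ⊕ x (k , 0)
        bottom-step k k<n = cong (_⊕ x (k , 0)) (δ-binary (bottom-binary k k<n) hor)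

        right-step : ∀ k → k < n →
          x (suc k , n ∸ suc k) ≡ χ (right n C k) · edgeVector dg ⊕ x (k , n ∸ k)
        right-step k k<n = trans (x-isPotential dg k (n ∸ suc k) (+∸-suc< k<n))
          (cong₂ _⊕_ (δ-binary (right-binary k k<n) dg) (cong (λ s → x (k , s)) (sym (∸-suc k<n))))

      module S₀ = SideSteps {δ₀} {χ₀} δ₀-binary P₀-isPotential
      module S₁ = SideSteps {δ₁} {χ₁} δ₁-binary P₁-isPotential

      zeros ones balance : (ℕ → Color) → ℤ
      zeros   w = ∑ n (χ₀ ∘ w)
      ones    w = ∑ n (χ₁ ∘ w)
      balance w = crossSum (χ₀ ∘ w) (χ₁ ∘ w) n

      module _ {β : V → V → ℤ} (isBilinear : IsBilinear β) where
        open IsBilinear isBilinear using (scaledˡ; scaledʳ)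

        left-sum : ∑[ k < n ] altForm β P₀ P₁ up 0 k
                 ≡ balance (left n C) * β (edgeVector up) (edgeVector up)
        left-sum = altForm-segment-origin isBilinear (λ k → P₀ (0 , k)) (λ k → P₁ (0 , k))
          (χ₀ ∘ left n C) (χ₁ ∘ left n C) (edgeVector up) n
          S₀.left-step S₁.left-step refl refl

        bottom-sum : ∑[ k < n ] altForm β P₀ P₁ hor k 0
                   ≡ balance (bottom n C) * β (edgeVector hor) (edgeVector hor)
        bottom-sum = altForm-segment-origin isBilinear (λ k → P₀ (k , 0)) (λ k → P₁ (k , 0))
          (χ₀ ∘ bottom n C) (χ₁ ∘ bottom n C) (edgeVector hor) n
          S₀.bottom-step S₁.bottom-step refl refl

        right-sum : ∑[ k < n ] altForm β P₀ P₁ dg k (n ∸ suc k)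
          ≡ ones (right n C) * (zeros (left n C) * β (edgeVector up) (edgeVector dg))
            - zeros (right n C) * (ones (left n C) * β (edgeVector dg) (edgeVector up))
            + balance (right n C) * β (edgeVector dg) (edgeVector dg)
        right-sum = begin
          ∑[ k < n ] altForm β P₀ P₁ dg k (n ∸ suc k)
            ≡⟨ ∑-cong n (λ k k<n → cong (λ s → β (P₀ (k , s)) (P₁ (suc k , n ∸ suc k))
                                              - β (P₀ (suc k , n ∸ suc k)) (P₁ (k , s)))
                                        (sym (∸-suc k<n))) ⟩
          ∑[ k < n ] (β (x k) (y (suc k)) - β (x (suc k)) (y k))
            ≡⟨ altForm-segment isBilinear x y (χ₀ ∘ right n C) (χ₁ ∘ right n C) (edgeVector dg) n
                 S₀.right-step S₁.right-step ⟩
          ones (right n C) * β (P₀ (0 , n)) (edgeVector dg)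
            - zeros (right n C) * β (edgeVector dg) (P₁ (0 , n))
            + balance (right n C) * β (edgeVector dg) (edgeVector dg)
            ≡⟨ cong₂ (λ p q → ones (right n C) * p - zeros (right n C) * q
                                + balance (right n C) * β (edgeVector dg) (edgeVector dg))
                     (trans (cong (λ v → β v (edgeVector dg))
                                  (segment-position (λ k → P₀ (0 , k)) (χ₀ ∘ left n C) (edgeVector up) n
                                                    S₀.left-step n ℕ.≤-refl))
                            (scaledˡ (zeros (left n C)) (edgeVector up) (edgeVector dg)))
                     (trans (cong (β (edgeVector dg))
                                  (segment-position (λ k → P₁ (0 , k)) (χ₁ ∘ left n C) (edgeVector up) n
                                                    S₁.left-step n ℕ.≤-refl))
                            (scaledʳ (ones (left n C)) (edgeVector dg) (edgeVector up))) ⟩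
          ones (right n C) * (zeros (left n C) * β (edgeVector up) (edgeVector dg))
            - zeros (right n C) * (ones (left n C) * β (edgeVector dg) (edgeVector up))
            + balance (right n C) * β (edgeVector dg) (edgeVector dg) ∎
          where
          open ≡-Reasoning
          x y : ℕ → V
          x k = P₀ (k , n ∸ k)
          y k = P₁ (k , n ∸ k)

        boundaryCirc-correctedForm : ∀ ρ → ρ c0 ≡ 0ℤ → ρ c1 ≡ 0ℤ →
          boundaryCirc n (correctedForm β ρ)
            ≡ balance (left n C) * β (edgeVector up) (edgeVector up)
              + (ones (right n C) * (zeros (left n C) * β (edgeVector up) (edgeVector dg))
                 - zeros (right n C) * (ones (left n C) * β (edgeVector dg) (edgeVector up))
                 + balance (right n C) * β (edgeVector dg) (edgeVector dg))
              - balance (bottom n C) * β (edgeVector hor) (edgeVector hor)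
        boundaryCirc-correctedForm ρ ρ₀ ρ₁ = cong₂ _-_
          (cong₂ _+_ (trans (∑-cong n (λ k k<n → uncorrected up 0 k (left-binary k k<n))) left-sum)
                     (trans (∑-cong n (λ k k<n → uncorrected dg k (n ∸ suc k) (right-binary k k<n)))
                            right-sum))
          (trans (∑-cong n (λ k k<n → uncorrected hor k 0 (bottom-binary k k<n))) bottom-sum)
          where
          uncorrected : ∀ d r s → Binary (C d r s) → correctedForm β ρ d r s ≡ altForm β P₀ P₁ d r s
          uncorrected d r s binary = trans
            (cong (_+_ (altForm β P₀ P₁ d r s)) (oriented-binary {ρ} ρ₀ ρ₁ binary d))
            (ℤ.+-identityʳ (altForm β P₀ P₁ d r s))

      upFaceCount : Color → ℕ → ℕ → ℤ
      upFaceCount k r s = + edgeCount k (C dg r s) (C hor r s) (C up r s)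

      rhombus-sum : (+ sC n C + + mC n C) * - + 2
                  ≡ - (ones (right n C) * zeros (left n C) + zeros (right n C) * ones (left n C))
      rhombus-sum = begin
        (+ sC n C + + mC n C) * - + 2
          ≡⟨ cong (_* - + 2) (trans (cong₂ _+_ (pos-countColor c3) (pos-countColor cm))
                                    (sym (∑△-distrib-+ n (upFaceCount c3) (upFaceCount cm)))) ⟩
        ∑△ n (λ r s → upFaceCount c3 r s + upFaceCount cm r s) * - + 2
          ≡⟨ *-distribʳ-∑△ n (λ r s → upFaceCount c3 r s + upFaceCount cm r s) (- + 2) ⟩
        ∑△ n (λ r s → (upFaceCount c3 r s + upFaceCount cm r s) * - + 2)
          ≡⟨ faces≡boundary (form-isBilinear 0ℤ 1ℤ -1ℤ 0ℤ) detCorrection _ det-faces ⟩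
        boundaryCirc n (correctedForm det detCorrection)
          ≡⟨ boundaryCirc-correctedForm (form-isBilinear 0ℤ 1ℤ -1ℤ 0ℤ) detCorrection refl refl ⟩
        balance (left n C) * 0ℤ
          + (ones (right n C) * (zeros (left n C) * -1ℤ) - zeros (right n C) * (ones (left n C) * 1ℤ)
             + balance (right n C) * 0ℤ)
          - balance (bottom n C) * 0ℤ
          ≡⟨ simplify (balance (left n C)) (balance (right n C)) (balance (bottom n C))
                      (ones (right n C)) (zeros (left n C)) (zeros (right n C)) (ones (left n C)) ⟩
        - (ones (right n C) * zeros (left n C) + zeros (right n C) * ones (left n C)) ∎
        where
        open ≡-Reasoning
        simplify : ∀ k k′ k″ t z z′ t′ →
          k * 0ℤ + (t * (z * -1ℤ) - z′ * (t′ * 1ℤ) + k′ * 0ℤ) - k″ * 0ℤ ≡ - (t * z + z′ * t′)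
        simplify = solve-∀

      rhombus-difference : (+ sC n C - + mC n C) * + 2
        ≡ (balance (left n C) + balance (right n C) - balance (bottom n C)) * + 2
          + (zeros (right n C) * ones (left n C) - ones (right n C) * zeros (left n C))
      rhombus-difference = begin
        (+ sC n C - + mC n C) * + 2
          ≡⟨ cong (_* + 2) (trans (cong₂ _-_ (pos-countColor c3) (pos-countColor cm))
                                  (sym (∑△-distrib-minus n (upFaceCount c3) (upFaceCount cm)))) ⟩
        ∑△ n (λ r s → upFaceCount c3 r s - upFaceCount cm r s) * + 2
          ≡⟨ *-distribʳ-∑△ n (λ r s → upFaceCount c3 r s - upFaceCount cm r s) (+ 2) ⟩
        ∑△ n (λ r s → (upFaceCount c3 r s - upFaceCount cm r s) * + 2)
          ≡⟨ faces≡boundary (form-isBilinear (+ 2) 1ℤ 1ℤ (+ 2)) innerCorrection _ twiceInner-faces ⟩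
        boundaryCirc n (correctedForm twiceInner innerCorrection)
          ≡⟨ boundaryCirc-correctedForm (form-isBilinear (+ 2) 1ℤ 1ℤ (+ 2)) innerCorrection refl refl ⟩
        balance (left n C) * + 2
          + (ones (right n C) * (zeros (left n C) * -1ℤ) - zeros (right n C) * (ones (left n C) * -1ℤ)
             + balance (right n C) * + 2)
          - balance (bottom n C) * + 2
          ≡⟨ simplify (balance (left n C)) (balance (right n C)) (balance (bottom n C))
                      (ones (right n C)) (zeros (left n C)) (zeros (right n C)) (ones (left n C)) ⟩
        (balance (left n C) + balance (right n C) - balance (bottom n C)) * + 2
          + (zeros (right n C) * ones (left n C) - ones (right n C) * zeros (left n C)) ∎
        where
        open ≡-Reasoning
        simplify : ∀ k k′ k″ t z z′ t′ →
          k * + 2 + (t * (z * -1ℤ) - z′ * (t′ * -1ℤ) + k′ * + 2) - k″ * + 2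
          ≡ (k + k′ - k″) * + 2 + (z′ * t′ - t * z)
        simplify = solve-∀

      module _ {n₀ n₁ : ℕ}
        (bottom₀ : countSide n (bottom n C) c0 ≡ n₀) (bottom₁ : countSide n (bottom n C) c1 ≡ n₁)
        (right₀  : countSide n (right n C) c0 ≡ n₀)  (right₁  : countSide n (right n C) c1 ≡ n₁)
        (left₀   : countSide n (left n C) c0 ≡ n₀)   (left₁   : countSide n (left n C) c1 ≡ n₁)
        where

        private
          a : ℤ
          a = + n₀ * + n₁

          zeros≡n₀ : ∀ {w} → countSide n w c0 ≡ n₀ → zeros w ≡ + n₀
          zeros≡n₀ count = trans (sym (pos-Σ< n _)) (cong +_ count)

          ones≡n₁ : ∀ {w} → countSide n w c1 ≡ n₁ → ones w ≡ + n₁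
          ones≡n₁ count = trans (sym (pos-Σ< n _)) (cong +_ count)

          pair : ∀ {w} → countSide n w c0 ≡ n₀ → countSide n w c1 ≡ n₁ →
            + gashAfter n w + + gashBefore n w ≡ a
          pair {w} count₀ count₁ =
            trans (gashAfter+gashBefore w n) (cong₂ _*_ (zeros≡n₀ count₀) (ones≡n₁ count₁))

          total : + sC n C + + mC n C ≡ a
          total = ℤ.*-cancelʳ-≡ (+ sC n C + + mC n C) a (- + 2) (begin
            (+ sC n C + + mC n C) * - + 2
              ≡⟨ rhombus-sum ⟩
            - (ones (right n C) * zeros (left n C) + zeros (right n C) * ones (left n C))
              ≡⟨ cong₂ (λ p q → - (p + q))
                       (cong₂ _*_ (ones≡n₁ right₁) (zeros≡n₀ left₀))
                       (cong₂ _*_ (zeros≡n₀ right₀) (ones≡n₁ left₁)) ⟩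
            - (+ n₁ * + n₀ + + n₀ * + n₁)
              ≡⟨ symmetric (+ n₀) (+ n₁) ⟩
            a * - + 2 ∎)
            where
            open ≡-Reasoning
            symmetric : ∀ x y → - (y * x + x * y) ≡ x * y * - + 2
            symmetric = solve-∀

          difference : + sC n C - + mC n C
                     ≡ balance (left n C) + balance (right n C) - balance (bottom n C)
          difference = ℤ.*-cancelʳ-≡ _ _ (+ 2) (begin
            (+ sC n C - + mC n C) * + 2
              ≡⟨ rhombus-difference ⟩
            B * + 2 + (zeros (right n C) * ones (left n C) - ones (right n C) * zeros (left n C))
              ≡⟨ cong (_+_ (B * + 2))
                      (cong₂ _-_ (cong₂ _*_ (zeros≡n₀ right₀) (ones≡n₁ left₁))
                                 (cong₂ _*_ (ones≡n₁ right₁) (zeros≡n₀ left₀))) ⟩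
            B * + 2 + (+ n₀ * + n₁ - + n₁ * + n₀)
              ≡⟨ cancel B (+ n₀) (+ n₁) ⟩
            B * + 2 ∎)
            where
            open ≡-Reasoning
            B : ℤ
            B = balance (left n C) + balance (right n C) - balance (bottom n C)
            cancel : ∀ k x y → k * + 2 + (x * y - y * x) ≡ k * + 2
            cancel = solve-∀

          pos-+₃ : ∀ x y z → + (x ℕ.+ y ℕ.+ z) ≡ + x + + y + + z
          pos-+₃ x y z = trans (ℤ.pos-+ (x ℕ.+ y) z) (cong (_+ + z) (ℤ.pos-+ x y))

          formulas : (+ mC n C + a ≡ + G0 n C + + G1 n C + + G2 n C)
                   × (+ sC n C + (+ G0 n C + + G1 n C + + G2 n C) ≡ + 2 * a)
          formulas = solve-rhombus-counts (+ sC n C) (+ mC n C) a (+ G0 n C) (+ G1 n C) (+ G2 n C)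
            (+ gashBefore n (bottom n C)) (+ gashAfter n (right n C)) (+ gashAfter n (left n C))
            total
            (trans difference
              (cong₂ _-_ (cong₂ _+_ (crossSum≡gashAfter-gashBefore (left n C) n)
                                    (crossSum≡gashAfter-gashBefore (right n C) n))
                         (crossSum≡gashAfter-gashBefore (bottom n C) n)))
            (pair bottom₀ bottom₁) (pair right₀ right₁) (pair left₀ left₁)

        gash-formulas : (mC n C ℕ.+ n₀ ℕ.* n₁ ≡ G0 n C ℕ.+ G1 n C ℕ.+ G2 n C)
                      × (sC n C ℕ.+ (G0 n C ℕ.+ G1 n C ℕ.+ G2 n C) ≡ 2 ℕ.* (n₀ ℕ.* n₁))
        gash-formulas =
            ℤ.+-injective (begin
              + (mC n C ℕ.+ n₀ ℕ.* n₁)          ≡⟨ ℤ.pos-+ (mC n C) (n₀ ℕ.* n₁) ⟩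
              + mC n C + + (n₀ ℕ.* n₁)          ≡⟨ cong (_+_ (+ mC n C)) (ℤ.pos-* n₀ n₁) ⟩
              + mC n C + a                      ≡⟨ proj₁ formulas ⟩
              + G0 n C + + G1 n C + + G2 n C    ≡⟨ sym (pos-+₃ (G0 n C) (G1 n C) (G2 n C)) ⟩
              + (G0 n C ℕ.+ G1 n C ℕ.+ G2 n C)  ∎)
          , ℤ.+-injective (begin
              + (sC n C ℕ.+ (G0 n C ℕ.+ G1 n C ℕ.+ G2 n C))
                ≡⟨ ℤ.pos-+ (sC n C) (G0 n C ℕ.+ G1 n C ℕ.+ G2 n C) ⟩
              + sC n C + + (G0 n C ℕ.+ G1 n C ℕ.+ G2 n C)
                ≡⟨ cong (_+_ (+ sC n C)) (pos-+₃ (G0 n C) (G1 n C) (G2 n C)) ⟩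
              + sC n C + (+ G0 n C + + G1 n C + + G2 n C)
                ≡⟨ proj₂ formulas ⟩
              + 2 * a
                ≡⟨ cong (_*_ (+ 2)) (sym (ℤ.pos-* n₀ n₁)) ⟩
              + 2 * + (n₀ ℕ.* n₁)
                ≡⟨ sym (ℤ.pos-* 2 (n₀ ℕ.* n₁)) ⟩
              + (2 ℕ.* (n₀ ℕ.* n₁)) ∎)
          where open ≡-Reasoning

open MixedArea using (Binary; binary₀; binary₁; module ColorMap)
open import Data.Nat.Base using (_+_; _*_; _≥_)
open import Data.Empty using (⊥-elim)
open import Data.Nat.Tactic.RingSolver using (solve-∀)

-- Binary boundaries from the counts

Σ<-distrib-+ : ∀ n (f g : ℕ → ℕ) → Σ< n (λ i → f i + g i) ≡ Σ< n f + Σ< n g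
Σ<-distrib-+ zero    f g = refl
Σ<-distrib-+ (suc n) f g = begin
  Σ< (suc n) (λ i → f i + g i)                   ≡⟨ Σ<-suc n (λ i → f i + g i) ⟩
  f 0 + g 0 + Σ< n (λ i → f (suc i) + g (suc i))
    ≡⟨ cong (f 0 + g 0 +_) (Σ<-distrib-+ n (f ∘ suc) (g ∘ suc)) ⟩
  f 0 + g 0 + (Σ< n (f ∘ suc) + Σ< n (g ∘ suc))  ≡⟨ interchange (f 0) (g 0) _ _ ⟩
  f 0 + Σ< n (f ∘ suc) + (g 0 + Σ< n (g ∘ suc))  ≡⟨ sym (cong₂ _+_ (Σ<-suc n f) (Σ<-suc n g)) ⟩
  Σ< (suc n) f + Σ< (suc n) g                    ∎
  where
  open ≡-Reasoning
  interchange : ∀ a b c d → a + b + (c + d) ≡ a + c + (b + d)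
  interchange = solve-∀

Σ<-≤ : ∀ n (f : ℕ → ℕ) → (∀ i → f i ≤ 1) → Σ< n f ≤ n
Σ<-≤ zero    f f≤1 = z≤n
Σ<-≤ (suc n) f f≤1 = subst (_≤ suc n) (sym (Σ<-suc n f))
  (ℕ.+-mono-≤ (f≤1 0) (Σ<-≤ n (f ∘ suc) (f≤1 ∘ suc)))

binaryWeight : Color → ℕ
binaryWeight c = [ c =ᶜ c0 ] + [ c =ᶜ c1 ]

binaryWeight≤1 : ∀ c → binaryWeight c ≤ 1
binaryWeight≤1 c0 = s≤s z≤n
binaryWeight≤1 c1 = s≤s z≤n
binaryWeight≤1 c3 = z≤n
binaryWeight≤1 cm = z≤n

head-binary : ∀ c {x n} → x ≤ n → binaryWeight c + x ≡ suc n → Binary c × x ≡ n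
head-binary c0 _   total = binary₀ , ℕ.suc-injective total
head-binary c1 _   total = binary₁ , ℕ.suc-injective total
head-binary c3 x≤n total = ⊥-elim (ℕ.1+n≰n (subst (_≤ _) total x≤n))
head-binary cm x≤n total = ⊥-elim (ℕ.1+n≰n (subst (_≤ _) total x≤n))

full-weight⇒binary : ∀ n (w : ℕ → Color) → Σ< n (binaryWeight ∘ w) ≡ n →
  ∀ k → k < n → Binary (w k)
full-weight⇒binary zero    w total k ()
full-weight⇒binary (suc n) w total = at
  where
  split : Binary (w 0) × Σ< n (binaryWeight ∘ w ∘ suc) ≡ n
  split = head-binary (w 0) (Σ<-≤ n (binaryWeight ∘ w ∘ suc) (binaryWeight≤1 ∘ w ∘ suc))
                      (trans (sym (Σ<-suc n (binaryWeight ∘ w))) total)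
  at : ∀ k → k < suc n → Binary (w k)
  at zero    _         = proj₁ split
  at (suc k) (s≤s k<n) = full-weight⇒binary n (w ∘ suc) (proj₂ split) k k<n

binary-side : ∀ {n n₀ n₁} (w : ℕ → Color) → n₀ + n₁ ≡ n →
  countSide n w c0 ≡ n₀ → countSide n w c1 ≡ n₁ → ∀ k → k < n → Binary (w k)
binary-side {n} w n₀+n₁≡n count₀ count₁ = full-weight⇒binary n w
  (trans (Σ<-distrib-+ n (λ i → [ w i =ᶜ c0 ]) (λ i → [ w i =ᶜ c1 ]))
         (trans (cong₂ _+_ count₀ count₁) n₀+n₁≡n))

theorem2p5 : (n n₀ n₁ : ℕ) → n ≥ 1 → n₀ + n₁ ≡ n →
    (C : ColoringData) → IsColorMap n C →
    countSide n (bottom n C) c0 ≡ n₀ → countSide n (bottom n C) c1 ≡ n₁ →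
    countSide n (right n C) c0 ≡ n₀ → countSide n (right n C) c1 ≡ n₁ →
    countSide n (left n C) c0 ≡ n₀ → countSide n (left n C) c1 ≡ n₁ →
    (mC n C + n₀ * n₁ ≡ G0 n C + G1 n C + G2 n C) ×
    (sC n C + (G0 n C + G1 n C + G2 n C) ≡ 2 * (n₀ * n₁))
theorem2p5 n n₀ n₁ _ n₀+n₁≡n C isC bottom₀ bottom₁ right₀ right₁ left₀ left₁ =
  gash-formulas bottom₀ bottom₁ right₀ right₁ left₀ left₁
  where
  open ColorMap n C isC
  open Boundary (binary-side (left n C) n₀+n₁≡n left₀ left₁)
                (binary-side (bottom n C) n₀+n₁≡n bottom₀ bottom₁)
                (binary-side (right n C) n₀+n₁≡n right₀ right₁)
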